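{- Let $(G,c,k)$ be an instance of \textsc{Multi-STC} with core vertices $\mathscr{C}$ and periphery vertices $\mathscr{P}$, and let $A\subseteq\mathscr{P}$ be a good periphery component. Then $(G,c,k)$ is a yes-instance if and only if $(G-(A\setminus A^*),c,k)$ is a yes-instance.
   Context: A $c$-colored labeling of $G=(V,E)$ is a partition $L=(S^1_L,\dots,S^c_L,W_L)$ of $E$; it is an STC-labeling if there are no $\{u,v\},\{v,w\}\in S^i_L$ ($u\ne w$) with $\{u,w\}\notin E$. \textsc{Multi-STC}: given $G$ and $c,k\in\mathbb{N}$, decide whether $G$ has a $c$-colored STC-labeling with $|W_L|\le k$. Fix an edge set $D\subseteq E$ such that $(V,E\setminus D)$ has maximum degree at most $\lfloor c/2\rfloor+1$; the core $\mathscr{C}$ is the set of vertices incident with an edge of $D$ and the periphery is $\mathscr{P}=V\setminus\mathscr{C}$. A periphery component is a connected component (vertex set) of $G[\mathscr{P}]$; for a periphery component $A$, $A^*:=N(\mathscr{C})\cap A$. Two labelings $L,L'$ are partially equal on $E'\subseteq E$ if for all $e\in E'$ and $i\in\{1,\dots,c\}$, $e\in S^i_L\iff e\in S^i_{L'}$. A periphery component $A$ is good if for every STC-labeling $L$ of $G$ with $E(A)\subseteq W_L$ there is an STC-labeling $L'$ of $G$ partially equal to $L$ on $E\setminus E(A)$ with $W_{L'}\cap E(A)=\emptyset$. Here $E(A)$ is the set of edges with both endpoints in $A$. -}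

module Defs where

open import Data.Nat using (ℕ; zero; suc; _+_; _≤_; ⌊_/2⌋; _<ᵇ_)
open import Data.Fin using (Fin; toℕ)
open import Data.Bool using (Bool; true; false; _∧_; not; T)
open import Data.Maybe using (Maybe; nothing; just; is-nothing)
open import Data.List using (List; []; _∷_; map; concatMap; allFin)
open import Data.Bool.ListAction using (any)
open import Data.Product using (Σ; ∃; _×_; _,_)
open import Function.Bundles using (_⇔_)
open import Relation.Nullary using (¬_)
open import Relation.Binary.PropositionalEquality using (_≡_; _≢_)

record Graph : Set where
  field
    n          : ℕ
    adj        : Fin n → Fin n → Bool
    adj-sym    : ∀ u v → adj u v ≡ adj v u
    adj-irrefl : ∀ u → adj u u ≡ false
open Graph public

VSet : ℕ → Set
VSet n = Fin n → Bool

allV : ∀ {n} → VSet n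
allV _ = true

countTrue : List Bool → ℕ
countTrue []            = 0
countTrue (true  ∷ bs)  = suc (countTrue bs)
countTrue (false ∷ bs)  = countTrue bs

-- A c-colored labeling: each (unordered) pair gets either a strong colour
-- `just i` (i ∈ {1..c}, i.e. edge in S^i) or `nothing` (edge in W).
-- Only the values on edges matter.
record Labeling (n c : ℕ) : Set where
  field
    lab     : Fin n → Fin n → Maybe (Fin c)
    lab-sym : ∀ u v → lab u v ≡ lab v u
open Labeling public

IsSTCOn : (G : Graph) (X : VSet (n G)) {c : ℕ} → Labeling (n G) c → Set
IsSTCOn G X {c} L =
  ∀ u v w → T (X u) → T (X v) → T (X w) →
  T (adj G u v) → T (adj G v w) → u ≢ w →
  ∀ (i : Fin c) → lab L u v ≡ just i → lab L v w ≡ just i →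
  T (adj G u w)

IsSTC : (G : Graph) {c : ℕ} → Labeling (n G) c → Set
IsSTC G L = IsSTCOn G allV L

weakCount : (G : Graph) (X : VSet (n G)) {c : ℕ} → Labeling (n G) c → ℕ
weakCount G X L =
  countTrue (concatMap (λ u → map (λ v →
     (toℕ u <ᵇ toℕ v) ∧ X u ∧ X v ∧ adj G u v ∧ is-nothing (lab L u v))
     (allFin (n G))) (allFin (n G)))

YesInstanceOn : (G : Graph) (X : VSet (n G)) (c k : ℕ) → Set
YesInstanceOn G X c k =
  Σ (Labeling (n G) c) λ L → IsSTCOn G X L × weakCount G X L ≤ k

YesInstance : Graph → ℕ → ℕ → Set
YesInstance G c k = YesInstanceOn G allV c k

YesInstanceMinus : (G : Graph) (S : VSet (n G)) (c k : ℕ) → Set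
YesInstanceMinus G S c k = YesInstanceOn G (λ v → not (S v)) c k

record Deletion (G : Graph) (c : ℕ) : Set where
  field
    D       : Fin (n G) → Fin (n G) → Bool
    D-sym   : ∀ u v → D u v ≡ D v u
    D⊆E     : ∀ u v → T (D u v) → T (adj G u v)
    deg-bnd : ∀ u → countTrue (map (λ v → adj G u v ∧ not (D u v))
                                   (allFin (n G))) ≤ ⌊ c /2⌋ + 1
open Deletion public

module _ {G : Graph} {c : ℕ} (Δ : Deletion G c) where

  core : VSet (n G)
  core u = any (λ v → D Δ u v) (allFin (n G))

  periphery : VSet (n G)
  periphery u = not (core u)

  data ReachP : Fin (n G) → Fin (n G) → Set where
    here : ∀ {u} → T (periphery u) → ReachP u u
    step : ∀ {u v w} → ReachP u v → T (adj G v w) → T (periphery w) → ReachP u w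

  IsPeripheryComponent : VSet (n G) → Set
  IsPeripheryComponent A =
    (∃ λ a → T (A a)) ×
    (∀ a → T (A a) → ∀ v → (T (A v) ⇔ ReachP a v))

  star : VSet (n G) → VSet (n G)
  star A u = A u ∧ any (λ w → adj G u w ∧ core w) (allFin (n G))

  minusStar : VSet (n G) → VSet (n G)
  minusStar A u = A u ∧ not (star A u)

IsGood : (G : Graph) (c : ℕ) → VSet (n G) → Set
IsGood G c A =
  ∀ (L : Labeling (n G) c) → IsSTC G L →
  (∀ u v → T (adj G u v) → T (A u) → T (A v) → lab L u v ≡ nothing) →
  Σ (Labeling (n G) c) λ L' → IsSTC G L' ×
    (∀ u v → T (adj G u v) → ¬ (T (A u) × T (A v)) → lab L' u v ≡ lab L u v) ×
    (∀ u v → T (adj G u v) → T (A u) → T (A v) → lab L' u v ≢ nothing)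

-- Write X = V \ (A \ A*) for the vertex set of G - (A \ A*).  Two facts
-- drive the proof.
--   * Closure (graph theory): a vertex of A \ A* is a periphery vertex with
--     no core neighbour, so all its neighbours lie in the periphery
--     component A.  Hence every edge of G that is not inside A is an edge of
--     G[X].
--   * Monotonicity (counting): the STC condition and the number of weak
--     edges only shrink when passing to an induced subgraph, and the weak
--     count only grows when the set of weak edges grows.
-- (⇒) Restrict a solution of G to G[X].
-- (⇐) Take a solution L of G[X] and make every edge inside A weak.  Since
--     all edges outside A lie in G[X], the result is an STC-labeling of G,
--     so goodness of A yields L' agreeing with it outside A and strong on
--     every edge inside A.  Each weak edge of L' is then a weak edge of
--     (G[X], L), so L' uses at most k weak edges.
module Submission where

open import Defs
open import Data.Nat using (ℕ; _≤_; z≤n; s≤s; _<ᵇ_)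
open import Data.Nat.Properties using (≤-trans; m≤n⇒m≤1+n)
open import Data.Fin using (Fin; toℕ)
open import Data.Bool using (Bool; true; false; _∧_; not; T; if_then_else_)
open import Data.Bool.Properties using (T-∧; ∧-comm)
open import Data.Unit using (tt)
open import Data.Empty using (⊥-elim)
open import Data.Maybe using (Maybe; nothing; just; is-nothing)
open import Data.List using (List; _∷_; map; allFin)
open import Data.Bool.ListAction using (any)
open import Data.List.Relation.Unary.Any as Any using ()
open import Data.List.Relation.Unary.Any.Properties using (any⁺)
open import Data.List.Membership.Propositional.Properties using (∈-allFin)
open import Data.List.Relation.Binary.Pointwise using (Pointwise; []; _∷_; concat⁺; map⁺)
open import Data.List.Relation.Binary.Pointwise.Properties using () renaming (refl to pointwise-refl)
open import Data.Product using (_×_; _,_; proj₁; proj₂)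
open import Function.Bundles using (_⇔_; mk⇔; Equivalence)
open import Relation.Nullary using (¬_)
open import Relation.Binary.PropositionalEquality
  using (_≡_; refl; sym; trans; subst; cong₂)

-- Boolean facts used to unfold the Boolean masks of Defs.  The left
-- conjunct is explicit since Agda cannot recover it from T (a ∧ b).

T-∧⁻ : ∀ a {b} → T (a ∧ b) → T a × T b
T-∧⁻ a = Equivalence.to (T-∧ {a})

T-∧⁺ : ∀ a {b} → T a → T b → T (a ∧ b)
T-∧⁺ a ta tb = Equivalence.from (T-∧ {a}) (ta , tb)

T-not : ∀ {b} → T (not b) → ¬ T b
T-not {true} () _

not-T : ∀ {b} → ¬ T b → T (not b)
not-T {true} ¬b = ¬b tt
not-T {false} _ = tt

T-is-nothing : ∀ {C : Set} {m : Maybe C} → T (is-nothing m) ⇔ m ≡ nothing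
T-is-nothing {m = nothing} = mk⇔ (λ _ → refl) (λ _ → tt)
T-is-nothing {m = just _}  = mk⇔ (λ ()) (λ ())

any-allFin : ∀ {n} (p : Fin n → Bool) v → T (p v) → T (any p (allFin n))
any-allFin p v pv = any⁺ p (Any.map (λ { refl → pv }) (∈-allFin v))

_⇒ᵇ_ : Bool → Bool → Set
a ⇒ᵇ b = T a → T b

countTrue-mono : ∀ {as bs} → Pointwise _⇒ᵇ_ as bs → countTrue as ≤ countTrue bs
countTrue-mono [] = z≤n
countTrue-mono {true ∷ _}  {true ∷ _}  (_ ∷ rest) = s≤s (countTrue-mono rest)
countTrue-mono {true ∷ _}  {false ∷ _} (imp ∷ _)  = ⊥-elim (imp tt)
countTrue-mono {false ∷ _} {true ∷ _}  (_ ∷ rest) = m≤n⇒m≤1+n (countTrue-mono rest)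
countTrue-mono {false ∷ _} {false ∷ _} (_ ∷ rest) = countTrue-mono rest

module _ (G : Graph) {c : ℕ} where

  weakTest : VSet (n G) → Labeling (n G) c → Fin (n G) → Fin (n G) → Bool
  weakTest X L u v =
    (toℕ u <ᵇ toℕ v) ∧ X u ∧ X v ∧ adj G u v ∧ is-nothing (lab L u v)

  WeakEdge : VSet (n G) → Labeling (n G) c → Fin (n G) → Fin (n G) → Set
  WeakEdge X L u v = T (X u) × T (X v) × T (adj G u v) × lab L u v ≡ nothing

  weakTest-transfer : ∀ {X Y L L'} u v →
    (WeakEdge X L u v → WeakEdge Y L' u v) →
    T (weakTest X L u v) → T (weakTest Y L' u v)
  weakTest-transfer {X} {Y} {L} {L'} u v imp t =
    let (ord , rest) = T-∧⁻ (toℕ u <ᵇ toℕ v) t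
        (xu , rest)  = T-∧⁻ (X u) rest
        (xv , rest)  = T-∧⁻ (X v) rest
        (uv , weak)  = T-∧⁻ (adj G u v) rest
        (yu , yv , uv' , weak') =
          imp (xu , xv , uv , Equivalence.to T-is-nothing weak)
    in T-∧⁺ (toℕ u <ᵇ toℕ v) ord (T-∧⁺ (Y u) yu (T-∧⁺ (Y v) yv
         (T-∧⁺ (adj G u v) uv' (Equivalence.from T-is-nothing weak'))))

  weakCount-mono : ∀ {X Y L L'} →
    (∀ u v → WeakEdge X L u v → WeakEdge Y L' u v) →
    weakCount G X L ≤ weakCount G Y L'
  weakCount-mono {X} {Y} {L} {L'} imp =
    countTrue-mono (concat⁺ (map⁺ (row X L) (row Y L') (pointwise-refl (λ {u} →
      map⁺ (weakTest X L u) (weakTest Y L' u)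
        (pointwise-refl (λ {v} → weakTest-transfer {X} {Y} {L} {L'} u v (imp u v)) {vertices}))
      {vertices})))
    where
      vertices : List (Fin (n G))
      vertices = allFin (n G)

      row : VSet (n G) → Labeling (n G) c → Fin (n G) → List Bool
      row Z M u = map (weakTest Z M u) vertices

  yesInstance-restrict : ∀ {X Y : VSet (n G)} {k} → (∀ v → T (X v) → T (Y v)) →
    YesInstanceOn G Y c k → YesInstanceOn G X c k
  yesInstance-restrict {X} {Y} X⊆Y (L , stc , few) =
    L ,
    (λ u v w xu xv xw → stc u v w (X⊆Y u xu) (X⊆Y v xv) (X⊆Y w xw)) ,
    ≤-trans (weakCount-mono {X} {Y} {L} {L} (λ u v (xu , xv , uv , weak) →
      X⊆Y u xu , X⊆Y v xv , uv , weak)) few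

eraseInside : ∀ {m c} → VSet m → Labeling m c → Labeling m c
lab (eraseInside A L) u v = if A u ∧ A v then nothing else lab L u v
lab-sym (eraseInside A L) u v =
  cong₂ (λ b l → if b then nothing else l) (∧-comm (A u) (A v)) (lab-sym L u v)

module _ {m c} (A : VSet m) (L : Labeling m c) where

  eraseInside-outside : ∀ u v → ¬ (T (A u) × T (A v)) →
    lab (eraseInside A L) u v ≡ lab L u v
  eraseInside-outside u v outside with A u ∧ A v in inside
  ... | false = refl
  ... | true  = ⊥-elim (outside (T-∧⁻ (A u) (subst T (sym inside) tt)))

  eraseInside-inside : ∀ u v → T (A u) → T (A v) → lab (eraseInside A L) u v ≡ nothing
  eraseInside-inside u v au av with A u ∧ A v in inside
  ... | true  = refl
  ... | false = ⊥-elim (subst T inside (T-∧⁺ (A u) au av))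

  eraseInside-strong : ∀ u v {i} → lab (eraseInside A L) u v ≡ just i →
    lab L u v ≡ just i × ¬ (T (A u) × T (A v))
  eraseInside-strong u v strong with A u ∧ A v in inside
  ... | false = strong , λ (au , av) → subst T inside (T-∧⁺ (A u) au av)

module _ (G : Graph) (c : ℕ) (A X : VSet (n G))
  (outside-in-X : ∀ u v → T (adj G u v) → ¬ (T (A u) × T (A v)) → T (X u) × T (X v))
  where

  -- Erasing inside A turns an STC-labeling of G[X] into one of G: the two
  -- strong edges of a violating path lie outside A, hence in G[X].
  eraseInside-STC : (L : Labeling (n G) c) → IsSTCOn G X L → IsSTC G (eraseInside A L)
  eraseInside-STC L stc u v w _ _ _ uv vw u≢w i uv-i vw-i =
    let (uv-i' , uv-out) = eraseInside-strong A L u v uv-i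
        (vw-i' , vw-out) = eraseInside-strong A L v w vw-i
        (xu , xv)        = outside-in-X u v uv uv-out
        (_ , xw)         = outside-in-X v w vw vw-out
    in stc u v w xu xv xw uv vw u≢w i uv-i' vw-i'

  yesInstance-lift : ∀ {k} → IsGood G c A → YesInstanceOn G X c k → YesInstance G c k
  yesInstance-lift good (L , stc , few) = L' , stc' , ≤-trans (weakCount-mono G {c} {allV} {X} {L'} {L} weak-in-X) few
    where
      erased = eraseInside A L
      lifted = good erased (eraseInside-STC L stc) (λ u v _ → eraseInside-inside A L u v)
      L'     = proj₁ lifted
      stc'   = proj₁ (proj₂ lifted)
      agree  = proj₁ (proj₂ (proj₂ lifted))
      strong = proj₂ (proj₂ (proj₂ lifted))

      -- A weak edge of L' is not inside A, so it is weak in L and lies in G[X].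
      weak-in-X : ∀ u v → WeakEdge G allV L' u v → WeakEdge G X L u v
      weak-in-X u v (_ , _ , uv , weak) =
        let outside   = λ ((au , av) : T (A u) × T (A v)) → strong u v uv au av weak
            (xu , xv) = outside-in-X u v uv outside
            same      = trans (agree u v uv outside) (eraseInside-outside A L u v outside)
        in xu , xv , uv , trans (sym same) weak

module _ {G : Graph} {c : ℕ} (Δ : Deletion G c) {A : VSet (n G)}
  (component : IsPeripheryComponent Δ A) where

  reach-periphery : ∀ {a v} → ReachP Δ a v → T (periphery Δ v)
  reach-periphery (here pv)     = pv
  reach-periphery (step _ _ pv) = pv

  interior-neighbour : ∀ {u v} → T (minusStar Δ A u) → T (adj G u v) → T (A v)
  interior-neighbour {u} {v} interior uv =
    Equivalence.from (reach v) (step (here u-periphery) uv v-periphery)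
    where
      au = proj₁ (T-∧⁻ (A u) interior)
      reach : ∀ w → T (A w) ⇔ ReachP Δ u w
      reach = proj₂ component u au
      u-periphery = reach-periphery (Equivalence.to (reach u) au)
      -- a core neighbour would put u into A*
      v-periphery : T (periphery Δ v)
      v-periphery = not-T λ v-core →
        T-not (proj₂ (T-∧⁻ (A u) interior)) (T-∧⁺ (A u) au
          (any-allFin (λ w → adj G u w ∧ core Δ w) v (T-∧⁺ (adj G u v) uv v-core)))

  outside-in-remainder : ∀ u v → T (adj G u v) → ¬ (T (A u) × T (A v)) →
    T (not (minusStar Δ A u)) × T (not (minusStar Δ A v))
  outside-in-remainder u v uv outside =
    not-T (λ iu → outside (proj₁ (T-∧⁻ (A u) iu) , interior-neighbour iu uv)) ,
    not-T (λ iv → outside (interior-neighbour iv vu , proj₁ (T-∧⁻ (A v) iv)))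
    where
      vu = subst T (adj-sym G u v) uv

proposition17 : (G : Graph) (c k : ℕ) (Δ : Deletion G c) (A : VSet (Graph.n G)) →
    IsPeripheryComponent Δ A → IsGood G c A →
    (YesInstance G c k ⇔ YesInstanceMinus G (minusStar Δ A) c k)
proposition17 G c k Δ A component good =
  mk⇔ (yesInstance-restrict G (λ _ _ → tt))
      (yesInstance-lift G c A _ (outside-in-remainder Δ component) good)
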